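{- Let $\varphi,\psi,\chi\in\mathrm{Fm}_{\mathsf S}$ and $a,b\in Ag$ with $a\neq b$. Then: (1) if $\vdash_{\mathsf S}\varphi\to\psi$, then $\vdash_{\mathsf S}B_a\neg K_b\psi\to B_a\neg K_b\varphi$; (2) if $\vdash_{\mathsf S}\varphi\to\psi$, then $\vdash_{\mathsf S}I_a\neg K_b\psi\to I_a\neg K_b\varphi$; (3) if $\vdash_{\mathsf S}\varphi\to\psi$ and $\vdash_{\mathsf S}\psi\to\chi$, then $\vdash_{\mathsf S}(S_{a,b}\varphi\land S_{a,b}\chi)\to S_{a,b}\psi$.
   Context: Let $Ag$ be a non-empty finite set of agents and $Var$ a countably infinite set of propositional variables. The formulas $\mathrm{Fm}_{\mathsf S}$ are generated by $\varphi::=p\mid\neg\varphi\mid\varphi\land\varphi\mid I_a\varphi\mid K_a\varphi\mid B_a\varphi$ ($p\in Var$, $a\in Ag$), with $\lor,\to$ classical abbreviations. The logic $\mathsf S$ ($\vdash_{\mathsf S}\varphi$ means $\varphi$ is derivable) has as axioms: all classical tautologies; for each $a$ and $\star\in\{K_a,B_a,I_a\}$, $\star(\varphi\to\psi)\to(\star\varphi\to\star\psi)$; $K_a\varphi\to\varphi$; $K_a\varphi\to K_aK_a\varphi$; $B_a\varphi\to\neg B_a\neg\varphi$; $K_a\varphi\to B_a\varphi$; $B_a\varphi\to K_aB_a\varphi$; $I_a\varphi\to\neg I_a\neg\varphi$; $I_a\varphi\to K_aI_a\varphi$; $I_a\varphi\to I_aK_a\varphi$; $I_a\varphi\to I_aI_a\varphi$;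 rules: modus ponens and necessitation for each $K_a,B_a,I_a$. $S_{a,b}\varphi:=K_a\varphi\land B_a\neg K_b\varphi\land I_a(\varphi\land\neg K_b\varphi)$. -}

module Defs where

open import Data.Nat using (ℕ; suc)
open import Data.Fin using (Fin)
open import Data.Bool using (Bool; true; false; not; _∧_)
open import Relation.Binary.PropositionalEquality using (_≡_)

Var : Set
Var = ℕ

data Fm (Ag : Set) : Set where
  var : Var → Fm Ag
  ¬'_ : Fm Ag → Fm Ag
  _∧'_ : Fm Ag → Fm Ag → Fm Ag
  I : Ag → Fm Ag → Fm Ag
  K : Ag → Fm Ag → Fm Ag
  B : Ag → Fm Ag → Fm Ag

infixr 6 _∧'_
infix 7 ¬'_

module _ {Ag : Set} where
  _∨'_ : Fm Ag → Fm Ag → Fm Ag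
  φ ∨' ψ = ¬' (¬' φ ∧' ¬' ψ)

  _⇒_ : Fm Ag → Fm Ag → Fm Ag
  φ ⇒ ψ = ¬' (φ ∧' ¬' ψ)

  infixr 4 _⇒_
  infixr 5 _∨'_

  -- Classical (propositional) evaluation: variables and modal subformulas
  -- are treated as propositional atoms, assigned truth values by v.
  ⟦_⟧ : Fm Ag → (Fm Ag → Bool) → Bool
  ⟦ var p ⟧ v = v (var p)
  ⟦ ¬' φ ⟧ v = not (⟦ φ ⟧ v)
  ⟦ φ ∧' ψ ⟧ v = ⟦ φ ⟧ v ∧ ⟦ ψ ⟧ v
  ⟦ I a φ ⟧ v = v (I a φ)
  ⟦ K a φ ⟧ v = v (K a φ)
  ⟦ B a φ ⟧ v = v (B a φ)

  -- φ is a classical tautology (substitution instance of a propositional tautology)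
  Tautology : Fm Ag → Set
  Tautology φ = ∀ (v : Fm Ag → Bool) → ⟦ φ ⟧ v ≡ true

  data Modality : Set where
    Km Bm Im : Modality

  box : Modality → Ag → Fm Ag → Fm Ag
  box Km = K
  box Bm = B
  box Im = I

  data ⊢S_ : Fm Ag → Set where
    taut : ∀ {φ} → Tautology φ → ⊢S φ
    distr : ∀ m a φ ψ → ⊢S (box m a (φ ⇒ ψ) ⇒ (box m a φ ⇒ box m a ψ))
    K-T : ∀ a φ → ⊢S (K a φ ⇒ φ)
    K-4 : ∀ a φ → ⊢S (K a φ ⇒ K a (K a φ))
    B-D : ∀ a φ → ⊢S (B a φ ⇒ ¬' B a (¬' φ))
    KB : ∀ a φ → ⊢S (K a φ ⇒ B a φ)
    BKB : ∀ a φ → ⊢S (B a φ ⇒ K a (B a φ))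
    I-D : ∀ a φ → ⊢S (I a φ ⇒ ¬' I a (¬' φ))
    IKI : ∀ a φ → ⊢S (I a φ ⇒ K a (I a φ))
    IIK : ∀ a φ → ⊢S (I a φ ⇒ I a (K a φ))
    III : ∀ a φ → ⊢S (I a φ ⇒ I a (I a φ))
    mp : ∀ {φ ψ} → ⊢S (φ ⇒ ψ) → ⊢S φ → ⊢S ψ
    nec : ∀ m a {φ} → ⊢S φ → ⊢S (box m a φ)

  infix 2 ⊢S_

  S : Ag → Ag → Fm Ag → Fm Ag
  S a b φ = K a φ ∧' (B a (¬' K b φ) ∧' I a (φ ∧' ¬' K b φ))

-- Every conjunct of S_{a,b} ψ is monotone or antitone in ψ: K_a ψ is monotone, while
-- ¬K_b ψ, and hence B_a ¬K_b ψ and I_a ¬K_b ψ, are antitone.  So K_a ψ is inherited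
-- from φ, B_a ¬K_b ψ from χ, and for the intention I_a (ψ ∧ ¬K_b ψ) one takes ψ from φ
-- and ¬K_b ψ from χ, combining the two intentions since every normal modality
-- distributes over ∧.
module Submission where

open import Defs
open import Data.Nat using (ℕ; zero; suc)
open import Data.Fin using (Fin)
open import Data.Fin.Patterns using (0F; 1F; 2F)
open import Data.Bool using (Bool; true; false; not; _∧_; T)
open import Data.Bool.Properties using (T-∧; T-≡)
open import Data.Vec using (Vec; []; _∷_; lookup; map)
open import Data.Vec.Properties using (lookup-map)
open import Data.Product using (_×_; _,_; proj₁; proj₂)
open import Function using (_∘_)
open import Function.Bundles using (Equivalence)
open import Relation.Binary.PropositionalEquality using (_≡_; sym; trans; cong; cong₂)
open import Relation.Nullary using (¬_)

open Equivalence using (to)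

private variable
  n : ℕ

data Schema (n : ℕ) : Set where
  atom : Fin n → Schema n
  ‵¬_  : Schema n → Schema n
  _‵∧_ : Schema n → Schema n → Schema n

infixr 6 _‵∧_
infix 7 ‵¬_

_‵⇒_ : Schema n → Schema n → Schema n
P ‵⇒ Q = ‵¬ (P ‵∧ ‵¬ Q)

infixr 4 _‵⇒_

p : Schema (suc n)
p = atom 0F

q : Schema (suc (suc n))
q = atom 1F

r : Schema (suc (suc (suc n)))
r = atom 2F

eval : Schema n → Vec Bool n → Bool
eval (atom i)  ρ = lookup ρ i
eval (‵¬ P)    ρ = not (eval P ρ)
eval (P ‵∧ Q) ρ = eval P ρ ∧ eval Q ρ

allValuations : ∀ n → (Vec Bool n → Bool) → Bool
allValuations zero   f = f []
allValuations (suc n) f = allValuations n (f ∘ (true ∷_)) ∧ allValuations n (f ∘ (false ∷_))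

allValuations-sound : ∀ n (f : Vec Bool n → Bool) → T (allValuations n f) → ∀ ρ → T (f ρ)
allValuations-sound zero    f h []          = h
allValuations-sound (suc n) f h (true ∷ ρ)  = allValuations-sound n _ (proj₁ (to T-∧ h)) ρ
allValuations-sound (suc n) f h (false ∷ ρ) = allValuations-sound n _ (proj₂ (to T-∧ h)) ρ

module _ {Ag : Set} where

  private variable
    φ φ′ ψ ψ′ χ : Fm Ag

  instantiate : Schema n → Vec (Fm Ag) n → Fm Ag
  instantiate (atom i)  σ = lookup σ i
  instantiate (‵¬ P)    σ = ¬' instantiate P σ
  instantiate (P ‵∧ Q) σ = instantiate P σ ∧' instantiate Q σ

  ⟦instantiate⟧ : ∀ (P : Schema n) σ v → ⟦ instantiate P σ ⟧ v ≡ eval P (map (λ φ → ⟦ φ ⟧ v) σ)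
  ⟦instantiate⟧ (atom i)  σ v = sym (lookup-map i _ σ)
  ⟦instantiate⟧ (‵¬ P)    σ v = cong not (⟦instantiate⟧ P σ v)
  ⟦instantiate⟧ (P ‵∧ Q) σ v = cong₂ _∧_ (⟦instantiate⟧ P σ v) (⟦instantiate⟧ Q σ v)

  -- For a concrete valid schema the implicit argument computes to ⊤ and is found by Agda.
  tautology : (P : Schema n) {_ : T (allValuations n (eval P))} (σ : Vec (Fm Ag) n) → ⊢S instantiate P σ
  tautology {n} P {valid} σ = taut λ v →
    trans (⟦instantiate⟧ P σ v) (to T-≡ (allValuations-sound n (eval P) valid _))

  ⇒-trans : ⊢S (φ ⇒ ψ) → ⊢S (ψ ⇒ χ) → ⊢S (φ ⇒ χ)
  ⇒-trans {φ} {ψ} {χ} φ⇒ψ ψ⇒χ =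
    mp (mp (tautology ((p ‵⇒ q) ‵⇒ (q ‵⇒ r) ‵⇒ p ‵⇒ r) (φ ∷ ψ ∷ χ ∷ [])) φ⇒ψ) ψ⇒χ

  contraposition : ⊢S (φ ⇒ ψ) → ⊢S (¬' ψ ⇒ ¬' φ)
  contraposition {φ} {ψ} = mp (tautology ((p ‵⇒ q) ‵⇒ ‵¬ q ‵⇒ ‵¬ p) (φ ∷ ψ ∷ []))

  ⇒-uncurry : ⊢S (φ ⇒ ψ ⇒ χ) → ⊢S (φ ∧' ψ ⇒ χ)
  ⇒-uncurry {φ} {ψ} {χ} = mp (tautology ((p ‵⇒ q ‵⇒ r) ‵⇒ p ‵∧ q ‵⇒ r) (φ ∷ ψ ∷ χ ∷ []))

  ∧-elimˡ : ⊢S (φ ∧' ψ ⇒ φ)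
  ∧-elimˡ {φ} {ψ} = tautology (p ‵∧ q ‵⇒ p) (φ ∷ ψ ∷ [])

  ∧-elimʳ : ⊢S (φ ∧' ψ ⇒ ψ)
  ∧-elimʳ {φ} {ψ} = tautology (p ‵∧ q ‵⇒ q) (φ ∷ ψ ∷ [])

  ⇒-∧-intro : ⊢S (φ ⇒ ψ) → ⊢S (φ ⇒ χ) → ⊢S (φ ⇒ ψ ∧' χ)
  ⇒-∧-intro {φ} {ψ} {χ} φ⇒ψ φ⇒χ =
    mp (mp (tautology ((p ‵⇒ q) ‵⇒ (p ‵⇒ r) ‵⇒ p ‵⇒ q ‵∧ r) (φ ∷ ψ ∷ χ ∷ [])) φ⇒ψ) φ⇒χ

  ∧-mono : ⊢S (φ ⇒ φ′) → ⊢S (ψ ⇒ ψ′) → ⊢S (φ ∧' ψ ⇒ φ′ ∧' ψ′)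
  ∧-mono φ⇒φ′ ψ⇒ψ′ = ⇒-∧-intro (⇒-trans ∧-elimˡ φ⇒φ′) (⇒-trans ∧-elimʳ ψ⇒ψ′)

  box-mono : ∀ m a → ⊢S (φ ⇒ ψ) → ⊢S (box m a φ ⇒ box m a ψ)
  box-mono m a φ⇒ψ = mp (distr m a _ _) (nec m a φ⇒ψ)

  box-∧ : ∀ m a → ⊢S (box m a φ ∧' box m a ψ ⇒ box m a (φ ∧' ψ))
  box-∧ {φ} {ψ} m a = ⇒-uncurry (⇒-trans
    (box-mono m a (tautology (p ‵⇒ q ‵⇒ p ‵∧ q) (φ ∷ ψ ∷ [])))
    (distr m a ψ (φ ∧' ψ)))

  ¬K-antitone : ∀ b → ⊢S (φ ⇒ ψ) → ⊢S (¬' K b ψ ⇒ ¬' K b φ)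
  ¬K-antitone b = contraposition ∘ box-mono Km b

  box-¬K-antitone : ∀ m a b → ⊢S (φ ⇒ ψ) → ⊢S (box m a (¬' K b ψ) ⇒ box m a (¬' K b φ))
  box-¬K-antitone m a b = box-mono m a ∘ ¬K-antitone b

  ∧¬K-convex : ∀ b → ⊢S (φ ⇒ ψ) → ⊢S (ψ ⇒ χ) →
    ⊢S ((φ ∧' ¬' K b φ) ∧' (χ ∧' ¬' K b χ) ⇒ ψ ∧' ¬' K b ψ)
  ∧¬K-convex b φ⇒ψ ψ⇒χ = ∧-mono (⇒-trans ∧-elimˡ φ⇒ψ) (⇒-trans ∧-elimʳ (¬K-antitone b ψ⇒χ))

  S-convex : ∀ a b → ⊢S (φ ⇒ ψ) → ⊢S (ψ ⇒ χ) → ⊢S (S a b φ ∧' S a b χ ⇒ S a b ψ)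
  S-convex a b φ⇒ψ ψ⇒χ =
    ⇒-∧-intro (⇒-trans ∧-elimˡ (⇒-trans S⇒K (box-mono Km a φ⇒ψ)))
   (⇒-∧-intro (⇒-trans ∧-elimʳ (⇒-trans S⇒B (box-¬K-antitone Bm a b ψ⇒χ)))
              (⇒-trans (∧-mono S⇒I S⇒I)
                (⇒-trans (box-∧ Im a) (box-mono Im a (∧¬K-convex b φ⇒ψ ψ⇒χ)))))
    where
    S⇒K : ⊢S (S a b φ ⇒ K a φ)
    S⇒K = ∧-elimˡ

    S⇒B : ⊢S (S a b χ ⇒ B a (¬' K b χ))
    S⇒B = ⇒-trans ∧-elimʳ ∧-elimˡ

    S⇒I : ∀ {θ} → ⊢S (S a b θ ⇒ I a (θ ∧' ¬' K b θ))
    S⇒I = ⇒-trans ∧-elimʳ ∧-elimʳ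

proposition7 : ∀ (n : ℕ) (φ ψ χ : Fm (Fin (suc n))) (a b : Fin (suc n)) → ¬ (a ≡ b) →
    ((⊢S (φ ⇒ ψ)) → ⊢S (B a (¬' K b ψ) ⇒ B a (¬' K b φ)))
    × ((⊢S (φ ⇒ ψ)) → ⊢S (I a (¬' K b ψ) ⇒ I a (¬' K b φ)))
    × ((⊢S (φ ⇒ ψ)) → (⊢S (ψ ⇒ χ)) → ⊢S ((S a b φ ∧' S a b χ) ⇒ S a b ψ))
proposition7 _ _ _ _ a b _ = box-¬K-antitone Bm a b , box-¬K-antitone Im a b , S-convex a b
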